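{- Let $T$ be a text of length $n$ and let $[p^-_1,p^-_2-1],\dots,[p^-_{k^- },p^-_{k^-+1}-1]$ (with $p^-_{k^-+1}=n+1$) be the input intervals of the balanced interval sequence $B(I_{SA})$ representing $\phi^{ -1}$. Let $i\in[1,n]$ and let $x$ be the integer with $p^-_x\le i<p^-_{x+1}$. Then (i) $PLCP[\phi^{ -1}(i)]=PLCP[\phi^{ -1}(p^-_x)]-(i-p^-_x)$; consequently (ii) for any $i,j\in[p^-_x,p^-_{x+1}-1]$, $PLCP[\phi^{ -1}(i)]=PLCP[\phi^{ -1}(p^-_x)]-(i-p^-_x)$, $PLCP[\phi^{ -1}(j)]=PLCP[\phi^{ -1}(p^-_x)]-(j-p^-_x)$, and $PLCP[\phi^{ -1}(i)]-PLCP[\phi^{ -1}(j)]=j-i$.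
   Context: $T=T[1]\cdots T[n]$ is a string whose last character $T[n]=\$$ is lexicographically smallest and unique. $SA$ is its suffix array, $ISA$ its inverse, the BWT $L$ has $L[i]=T[SA[i]-1]$ ($L[i]=T[n]$ if $SA[i]=1$), $L$ has $r$ maximal runs and $l_j$ is the start of the $j$-th run ($l_{r+1}=n+1$). $\phi^{ -1}(i)=SA[k+1]$ where $SA[k]=i$ ($\phi^{ -1}(i)=SA[1]$ if $i=SA[n]$). $LCP[1]=0$, $LCP[i]$ ($i\ge2$) is the length of the longest common prefix of $T[SA[i],n]$ and $T[SA[i-1],n]$, and $PLCP[j]=LCP[ISA[j]]$. $I_{SA}$ is the disjoint interval sequence (of Nishimoto and Tabei) representing $\phi^{ -1}$, whose input intervals start at the suffixes at the bottom of BWT runs, and $B(I_{SA})$ is its balanced interval sequence: a disjoint interval sequence of $O(r)$ intervals partitioning $[1,n]$ that refines these and represents the same bijection $\phi^{ -1}$; in particular $\{SA[l_2-1],SA[l_3-1],\dots,SA[l_r-1],SA[n]\}\subseteq\{p^-_1,\dots,p^-_{k^- }\}$, and $\phi^{ -1}(i)=\phi^{ -1}(p^-_x)+(i-p^-_x)$ for $p^-_x\le i<p^-_{x+1}$. -}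

module Defs where

open import Data.Nat using (ℕ; zero; suc; _+_; _∸_; _≤_; _<_; _>_; _≟_; _<ᵇ_; _≡ᵇ_)
open import Data.Bool using (Bool; true; false; if_then_else_; _∧_)
open import Data.Product using (_×_; ∃-syntax)
open import Data.Sum using (_⊎_)
open import Relation.Binary.PropositionalEquality using (_≡_; _≢_)
open import Relation.Nullary.Decidable using (⌊_⌋)

-- Conventions: a text of length n is a function T : ℕ → ℕ (characters are
-- natural numbers, ordered by _<_), used only at positions 1..n.
-- SA, ISA are functions ℕ → ℕ used on ranks/positions 1..n.

-- T[n] = $ is lexicographically smallest and unique.
IsText : ℕ → (ℕ → ℕ) → Set
IsText n T = (1 ≤ n) × (∀ j → 1 ≤ j → j < n → T n < T j)

AgreeFor : (ℕ → ℕ) → ℕ → ℕ → ℕ → Set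
AgreeFor T i j ℓ = ∀ t → t < ℓ → T (i + t) ≡ T (j + t)

SufLt : ℕ → (ℕ → ℕ) → ℕ → ℕ → Set
SufLt n T i j = ∃[ ℓ ] (AgreeFor T i j ℓ × (j + ℓ ≤ n) ×
                  ((i + ℓ > n) ⊎ ((i + ℓ ≤ n) × (T (i + ℓ) < T (j + ℓ)))))

IsSA : ℕ → (ℕ → ℕ) → (ℕ → ℕ) → Set
IsSA n T SA = (∀ k → 1 ≤ k → k ≤ n → (1 ≤ SA k) × (SA k ≤ n))
            × (∀ k k' → 1 ≤ k → k < k' → k' ≤ n → SufLt n T (SA k) (SA k'))

IsISA : ℕ → (ℕ → ℕ) → (ℕ → ℕ) → Set
IsISA n SA ISA = ∀ j → 1 ≤ j → j ≤ n → (1 ≤ ISA j) × (ISA j ≤ n) × (SA (ISA j) ≡ j)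

-- length of the longest common prefix of T[i..n] and T[j..n]
-- (fuel f bounds the number of compared characters; fuel n suffices)
lcpGo : ℕ → (ℕ → ℕ) → ℕ → ℕ → ℕ → ℕ
lcpGo n T zero i j = 0
lcpGo n T (suc f) i j =
  if (⌊ i Data.Nat.≤? n ⌋ ∧ ⌊ j Data.Nat.≤? n ⌋ ∧ ⌊ T i ≟ T j ⌋)
  then suc (lcpGo n T f (suc i) (suc j)) else 0

lcp : ℕ → (ℕ → ℕ) → ℕ → ℕ → ℕ
lcp n T i j = lcpGo n T n i j

LCP : ℕ → (ℕ → ℕ) → (ℕ → ℕ) → ℕ → ℕ
LCP n T SA zero = 0
LCP n T SA (suc zero) = 0
LCP n T SA (suc (suc k)) = lcp n T (SA (suc (suc k))) (SA (suc k))

PLCP : ℕ → (ℕ → ℕ) → (ℕ → ℕ) → (ℕ → ℕ) → ℕ → ℕ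
PLCP n T SA ISA j = LCP n T SA (ISA j)

phiInv : ℕ → (ℕ → ℕ) → (ℕ → ℕ) → ℕ → ℕ
phiInv n SA ISA i = if ISA i ≡ᵇ n then SA 1 else SA (suc (ISA i))

BWT : ℕ → (ℕ → ℕ) → (ℕ → ℕ) → ℕ → ℕ
BWT n T SA k = if SA k ≡ᵇ 1 then T n else T (SA k ∸ 1)

-- rank k is the last position of a maximal run of L, i.e. k = l_{j+1} - 1
-- for some j ∈ [1,r] (the bottom of the j-th BWT run)
IsRunEnd : ℕ → (ℕ → ℕ) → (ℕ → ℕ) → ℕ → Set
IsRunEnd n T SA k = (k ≡ n) ⊎ ((k < n) × (BWT n T SA k ≢ BWT n T SA (suc k)))

-- Interval sequence p_1 < ... < p_{kk+1} with p_1 = 1, p_{kk+1} = n+1,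
-- whose input intervals [p_x, p_{x+1}-1] partition [1,n] and which has the
-- properties of B(I_SA) stated in the context: every SA[l_{j+1}-1]
-- (j = 1..r) is a start p_x, and φ⁻¹ is shifted by a constant on each
-- input interval.
IsBalancedSeqPhiInv : ℕ → (ℕ → ℕ) → (ℕ → ℕ) → (ℕ → ℕ) → ℕ → (ℕ → ℕ) → Set
IsBalancedSeqPhiInv n T SA ISA kk p =
    (1 ≤ kk)
  × (p 1 ≡ 1)
  × (p (suc kk) ≡ suc n)
  × (∀ x → 1 ≤ x → x ≤ kk → p x < p (suc x))
  × (∀ k → 1 ≤ k → k ≤ n → IsRunEnd n T SA k →
       ∃[ x ] ((1 ≤ x) × (x ≤ kk) × (p x ≡ SA k)))
  × (∀ x i → 1 ≤ x → x ≤ kk → p x ≤ i → i < p (suc x) →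
       phiInv n SA ISA i ≡ phiInv n SA ISA (p x) + (i ∸ p x))

-- Inside an input interval, consecutive positions j, j + 1 have φ⁻¹(j + 1) = φ⁻¹(j) + 1,
-- and ISA[j + 1] is not the bottom of a BWT run (those are interval starts). So the
-- BWT letters at ranks ISA[j + 1] and ISA[j + 1] + 1, namely T[j] and T[φ⁻¹(j)], agree,
-- and the common prefix of the suffixes at φ⁻¹(j) and j is one longer than that of the
-- suffixes at φ⁻¹(j) + 1 and j + 1. Telescoping over the interval gives the claim.
module Submission where

open import Defs
open import Data.Nat
  using (ℕ; zero; suc; _+_; _∸_; _≤_; _<_; _≤′_; ≤′-reflexive; ≤′-step; z≤n; s≤s; _≤?_; _≟_; _≡ᵇ_)
open import Data.Nat.Properties
open import Data.Integer using (ℤ; +_; _-_)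
open import Data.Bool using (true; false)
import Data.Bool as Bool
open import Data.Product using (_×_; _,_; proj₁; proj₂; ∃-syntax)
open import Data.Sum using (inj₁; inj₂)
open import Data.Empty using (⊥-elim)
open import Relation.Nullary using (yes; no; ¬_)
open import Relation.Binary.Definitions using (tri<; tri≈; tri>)
open import Relation.Binary.PropositionalEquality
  using (_≡_; refl; sym; trans; cong; cong₂; subst; subst₂; _≢_; module ≡-Reasoning)
import Data.Integer as ℤ
import Data.Integer.Properties as ℤ
open import Data.Integer.Tactic.RingSolver using (solve-∀)

open ≡-Reasoning

a+[i∸s]≡b⇒+a≡+b-[+i-+s] : ∀ {a b i s} → s ≤ i → a + (i ∸ s) ≡ b → + a ≡ + b - (+ i - + s)
a+[i∸s]≡b⇒+a≡+b-[+i-+s] {a} {b} {i} {s} s≤i a+d≡b = begin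
  + a                                         ≡⟨ cancel (+ a) (+ d) (+ s) ⟩
  (+ a ℤ.+ + d) - ((+ s ℤ.+ + d) - + s)       ≡⟨ cong₂ (λ u v → u - (v - + s)) (sym (ℤ.pos-+ a d)) (sym (ℤ.pos-+ s d)) ⟩
  + (a + d) - (+ (s + d) - + s)               ≡⟨ cong₂ (λ u v → + u - (+ v - + s)) a+d≡b (m+[n∸m]≡n s≤i) ⟩
  + b - (+ i - + s)                           ∎
  where
  d = i ∸ s
  cancel : ∀ (u v w : ℤ) → u ≡ (u ℤ.+ v) - ((w ℤ.+ v) - w)
  cancel = solve-∀

[b-[i-s]]-[b-[j-s]]≡j-i : ∀ (b i j s : ℤ) → (b - (i - s)) - (b - (j - s)) ≡ j - i
[b-[i-s]]-[b-[j-s]]≡j-i = solve-∀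

telescope : (f : ℕ → ℕ) {a b : ℕ} →
  (∀ j → a ≤ j → suc j < b → suc (f (suc j)) ≡ f j) →
  ∀ i → a ≤ i → i < b → f i + (i ∸ a) ≡ f a
telescope f {a} {b} step i a≤i i<b =
  subst (λ k → f k + (i ∸ a) ≡ f a) (m+[n∸m]≡n a≤i)
    (offset (i ∸ a) (subst (_< b) (sym (m+[n∸m]≡n a≤i)) i<b))
  where
  offset : ∀ d → a + d < b → f (a + d) + d ≡ f a
  offset zero h rewrite +-identityʳ a = +-identityʳ (f a)
  offset (suc d) h rewrite +-suc a d = begin
    f (suc (a + d)) + suc d     ≡⟨ +-suc _ d ⟩
    suc (f (suc (a + d))) + d   ≡⟨ cong (_+ d) (step (a + d) (m≤m+n a d) h) ⟩
    f (a + d) + d               ≡⟨ offset d (<-trans (n<1+n _) h) ⟩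
    f a                         ∎

lcpGo-step : ∀ n T f a b → a ≤ n → b ≤ n → T a ≡ T b →
  lcpGo n T (suc f) a b ≡ suc (lcpGo n T f (suc a) (suc b))
lcpGo-step n T f a b a≤n b≤n Ta≡Tb with a ≤? n | b ≤? n | T a ≟ T b
... | yes _ | yes _ | yes _     = refl
... | no a≰n | _ | _           = ⊥-elim (a≰n a≤n)
... | yes _ | no b≰n | _       = ⊥-elim (b≰n b≤n)
... | yes _ | yes _ | no Ta≢Tb = ⊥-elim (Ta≢Tb Ta≡Tb)

lcpGo-fuel : ∀ n T f a b → suc n ∸ a ≤ f → lcpGo n T (suc f) a b ≡ lcpGo n T f a b
lcpGo-fuel n T zero a b h with a ≤? n
... | no _    = refl
... | yes a≤n = ⊥-elim (n≮0 (≤-trans (≤-reflexive (sym (+-∸-assoc 1 a≤n))) h))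
lcpGo-fuel n T (suc f) a b h with a ≤? n
... | no _ = refl
... | yes a≤n with b ≤? n
...   | no _ = refl
...   | yes _ with T a ≟ T b
...     | no _  = refl
...     | yes _ = cong suc (lcpGo-fuel n T f (suc a) (suc b)
                    (≤-pred (≤-trans (≤-reflexive (sym (+-∸-assoc 1 a≤n))) h)))

lcp-suc : ∀ n T a b → 1 ≤ a → a ≤ n → b ≤ n → T a ≡ T b →
  lcp n T a b ≡ suc (lcp n T (suc a) (suc b))
lcp-suc zero    T (suc _) _ _ () _ _
lcp-suc (suc n) T a b 1≤a a≤n b≤n Ta≡Tb = begin
  lcpGo (suc n) T (suc n) a b                     ≡⟨ lcpGo-step (suc n) T n a b a≤n b≤n Ta≡Tb ⟩
  suc (lcpGo (suc n) T n (suc a) (suc b))         ≡⟨ cong suc (lcpGo-fuel (suc n) T n (suc a) (suc b) (∸-monoʳ-≤ (suc n) 1≤a)) ⟨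
  suc (lcpGo (suc n) T (suc n) (suc a) (suc b))   ∎

increasing⇒monotone : ∀ {kk} (p : ℕ → ℕ) → (∀ x → 1 ≤ x → x ≤ kk → p x < p (suc x)) →
  ∀ {x y} → 1 ≤ x → x ≤ y → y ≤ suc kk → p x ≤ p y
increasing⇒monotone {kk} p p-inc {x} 1≤x x≤y = go (≤⇒≤′ x≤y)
  where
  go : ∀ {y} → x ≤′ y → y ≤ suc kk → p x ≤ p y
  go (≤′-reflexive refl) _ = ≤-refl
  go {suc y} (≤′-step x≤′y) 1+y≤1+kk =
    ≤-trans (go x≤′y (≤-trans (n≤1+n y) 1+y≤1+kk))
            (<⇒≤ (p-inc y (≤-trans 1≤x (≤′⇒≤ x≤′y)) (≤-pred 1+y≤1+kk)))

shift-suc : ∀ (f : ℕ → ℕ) {a b} → (∀ i → a ≤ i → i < b → f i ≡ f a + (i ∸ a)) →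
  ∀ {j} → a ≤ j → suc j < b → f (suc j) ≡ suc (f j)
shift-suc f {a} shift {j} a≤j 1+j<b = begin
  f (suc j)              ≡⟨ shift (suc j) (≤-trans a≤j (n≤1+n j)) 1+j<b ⟩
  f a + (suc j ∸ a)      ≡⟨ cong (λ d → f a + d) (+-∸-assoc 1 a≤j) ⟩
  f a + suc (j ∸ a)      ≡⟨ +-suc (f a) (j ∸ a) ⟩
  suc (f a + (j ∸ a))    ≡⟨ cong suc (shift j a≤j (<-trans (n<1+n j) 1+j<b)) ⟨
  suc (f j)              ∎

LCP-suc : ∀ n T SA {k} → 1 ≤ k → LCP n T SA (suc k) ≡ lcp n T (SA (suc k)) (SA k)
LCP-suc n T SA (s≤s z≤n) = refl

BWT-at : ∀ n T SA {k a} → 1 ≤ a → SA k ≡ suc a → BWT n T SA k ≡ T a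
BWT-at n T SA {a = suc _} _ SA-k≡1+a rewrite SA-k≡1+a = refl

SufLt-irrefl : ∀ n T a → ¬ SufLt n T a a
SufLt-irrefl n T a (_ , _ , a+ℓ≤n , inj₁ a+ℓ>n)   = <⇒≱ a+ℓ>n a+ℓ≤n
SufLt-irrefl n T a (_ , _ , _ , inj₂ (_ , Tc<Tc)) = <-irrefl refl Tc<Tc

module SuffixArray {n : ℕ} {T SA ISA : ℕ → ℕ}
  (text : IsText n T) (sa : IsSA n T SA) (isa : IsISA n SA ISA) where

  PLCPφ⁻¹ : ℕ → ℕ
  PLCPφ⁻¹ i = PLCP n T SA ISA (phiInv n SA ISA i)

  SA-bounds : ∀ {k} → 1 ≤ k → k ≤ n → 1 ≤ SA k × SA k ≤ n
  SA-bounds = proj₁ sa _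

  SA-injective : ∀ {k k′} → 1 ≤ k → k ≤ n → 1 ≤ k′ → k′ ≤ n → SA k ≡ SA k′ → k ≡ k′
  SA-injective {k} {k′} 1≤k k≤n 1≤k′ k′≤n SA-k≡SA-k′ with <-cmp k k′
  ... | tri≈ _ k≡k′ _ = k≡k′
  ... | tri< k<k′ _ _ = ⊥-elim (SufLt-irrefl n T (SA k′)
                          (subst (λ a → SufLt n T a (SA k′)) SA-k≡SA-k′ (proj₂ sa k k′ 1≤k k<k′ k′≤n)))
  ... | tri> _ _ k′<k = ⊥-elim (SufLt-irrefl n T (SA k)
                          (subst (λ a → SufLt n T a (SA k)) (sym SA-k≡SA-k′) (proj₂ sa k′ k 1≤k′ k′<k k≤n)))

  ISA-SA : ∀ {k} → 1 ≤ k → k ≤ n → ISA (SA k) ≡ k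
  ISA-SA 1≤k k≤n with SA-bounds 1≤k k≤n
  ... | 1≤SA , SA≤n with isa _ 1≤SA SA≤n
  ...   | 1≤ISA , ISA≤n , SA-ISA≡ = SA-injective 1≤ISA ISA≤n 1≤k k≤n SA-ISA≡

  T-last-≤ : ∀ {a} → 1 ≤ a → a ≤ n → T n ≤ T a
  T-last-≤ 1≤a a≤n with m≤n⇒m<n∨m≡n a≤n
  ... | inj₁ a<n  = <⇒≤ (proj₂ text _ 1≤a a<n)
  ... | inj₂ refl = ≤-refl

  ¬SufLt-last : ∀ {a} → 1 ≤ a → a ≤ n → ¬ SufLt n T a n
  ¬SufLt-last _ _ (suc ℓ , _ , n+1+ℓ≤n , _) = m+1+n≰m n n+1+ℓ≤n
  ¬SufLt-last {a} _ a≤n (zero , _ , _ , inj₁ a+0>n) =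
    <⇒≱ a+0>n (subst (_≤ n) (sym (+-identityʳ a)) a≤n)
  ¬SufLt-last {a} 1≤a a≤n (zero , _ , _ , inj₂ (_ , Ta+0<Tn+0)) =
    <⇒≱ (subst₂ (λ u v → T u < T v) (+-identityʳ a) (+-identityʳ n) Ta+0<Tn+0) (T-last-≤ 1≤a a≤n)

  SA-1≡n : SA 1 ≡ n
  SA-1≡n with isa n (proj₁ text) ≤-refl
  ... | 1≤k , k≤n , SA-k≡n with m≤n⇒m<n∨m≡n 1≤k
  ...   | inj₂ 1≡k = subst (λ k → SA k ≡ n) (sym 1≡k) SA-k≡n
  ...   | inj₁ 1<k = ⊥-elim (¬SufLt-last 1≤SA-1 SA-1≤n
                       (subst (SufLt n T (SA 1)) SA-k≡n (proj₂ sa 1 _ ≤-refl 1<k k≤n)))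
    where
    1≤SA-1 : 1 ≤ SA 1
    1≤SA-1 = proj₁ (SA-bounds ≤-refl (proj₁ text))
    SA-1≤n : SA 1 ≤ n
    SA-1≤n = proj₂ (SA-bounds ≤-refl (proj₁ text))

  phiInv-last : ∀ {i} → ISA i ≡ n → phiInv n SA ISA i ≡ n
  phiInv-last {i} ISA-i≡n with ISA i ≡ᵇ n in eq
  ... | true  = SA-1≡n
  ... | false = ⊥-elim (subst Bool.T (trans (cong (_≡ᵇ n) (sym ISA-i≡n)) eq) (≡⇒≡ᵇ n n refl))

  phiInv-notLast : ∀ {i} → ISA i ≢ n → phiInv n SA ISA i ≡ SA (suc (ISA i))
  phiInv-notLast {i} ISA-i≢n with ISA i ≡ᵇ n in eq
  ... | false = refl
  ... | true  = ⊥-elim (ISA-i≢n (≡ᵇ⇒≡ (ISA i) n (subst Bool.T (sym eq) _)))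

  PLCPφ⁻¹≡lcp : ∀ {j} → 1 ≤ j → j ≤ n → ISA j < n → PLCPφ⁻¹ j ≡ lcp n T (phiInv n SA ISA j) j
  PLCPφ⁻¹≡lcp {j} 1≤j j≤n k<n with isa j 1≤j j≤n
  ... | 1≤k , _ , SA-k≡j = begin
    PLCP n T SA ISA (phiInv n SA ISA j)  ≡⟨ cong (PLCP n T SA ISA) φ⁻¹j≡ ⟩
    LCP n T SA (ISA (SA (suc k)))        ≡⟨ cong (LCP n T SA) (ISA-SA (s≤s z≤n) k<n) ⟩
    LCP n T SA (suc k)                   ≡⟨ LCP-suc n T SA 1≤k ⟩
    lcp n T (SA (suc k)) (SA k)          ≡⟨ cong₂ (lcp n T) (sym φ⁻¹j≡) SA-k≡j ⟩
    lcp n T (phiInv n SA ISA j) j        ∎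
    where
    k = ISA j
    φ⁻¹j≡ : phiInv n SA ISA j ≡ SA (suc k)
    φ⁻¹j≡ = phiInv-notLast (<⇒≢ k<n)

  PLCPφ⁻¹-suc : ∀ {j} → 1 ≤ j → suc j ≤ n →
    ¬ IsRunEnd n T SA (ISA (suc j)) →
    phiInv n SA ISA (suc j) ≡ suc (phiInv n SA ISA j) →
    suc (PLCPφ⁻¹ (suc j)) ≡ PLCPφ⁻¹ j
  PLCPφ⁻¹-suc {j} 1≤j 1+j≤n notRunEnd φ⁻¹-suc with isa (suc j) (s≤s z≤n) 1+j≤n
  ... | 1≤k , k≤n , SA-k≡1+j = begin
    suc (PLCPφ⁻¹ (suc j))                           ≡⟨ cong suc (PLCPφ⁻¹≡lcp (s≤s z≤n) 1+j≤n k<n) ⟩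
    suc (lcp n T (phiInv n SA ISA (suc j)) (suc j)) ≡⟨ cong (λ a → suc (lcp n T a (suc j))) φ⁻¹-suc ⟩
    suc (lcp n T (suc q) (suc j))                   ≡⟨ lcp-suc n T q j 1≤q q≤n j≤n Tq≡Tj ⟨
    lcp n T q j                                     ≡⟨ PLCPφ⁻¹≡lcp 1≤j j≤n ISA-j<n ⟨
    PLCPφ⁻¹ j                                       ∎
    where
    k = ISA (suc j)
    q = phiInv n SA ISA j
    j≤n : j ≤ n
    j≤n = ≤-trans (n≤1+n j) 1+j≤n
    k<n : k < n
    k<n = ≤∧≢⇒< k≤n (λ k≡n → notRunEnd (inj₁ k≡n))
    SA-1+k≡1+q : SA (suc k) ≡ suc q
    SA-1+k≡1+q = trans (sym (phiInv-notLast (<⇒≢ k<n))) φ⁻¹-suc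
    SA-1+k≤n : SA (suc k) ≤ n
    SA-1+k≤n = proj₂ (SA-bounds (s≤s z≤n) k<n)
    -- if j were ranked last, φ⁻¹(j + 1) = SA[1] + 1 = n + 1 would be out of range
    ISA-j<n : ISA j < n
    ISA-j<n = ≤∧≢⇒< (proj₁ (proj₂ (isa j 1≤j j≤n))) λ ISA-j≡n →
      1+n≰n (subst (_≤ n) (trans SA-1+k≡1+q (cong suc (phiInv-last ISA-j≡n))) SA-1+k≤n)
    q-bounds : 1 ≤ q × q ≤ n
    q-bounds = subst (λ a → 1 ≤ a × a ≤ n) (sym (phiInv-notLast (<⇒≢ ISA-j<n)))
                 (SA-bounds (s≤s z≤n) ISA-j<n)
    1≤q : 1 ≤ q
    1≤q = proj₁ q-bounds
    q≤n : q ≤ n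
    q≤n = proj₂ q-bounds
    sameLetter : BWT n T SA k ≡ BWT n T SA (suc k)
    sameLetter with BWT n T SA k ≟ BWT n T SA (suc k)
    ... | yes eq  = eq
    ... | no diff = ⊥-elim (notRunEnd (inj₂ (k<n , diff)))
    Tq≡Tj : T q ≡ T j
    Tq≡Tj = begin
      T q                  ≡⟨ BWT-at n T SA 1≤q SA-1+k≡1+q ⟨
      BWT n T SA (suc k)   ≡⟨ sameLetter ⟨
      BWT n T SA k         ≡⟨ BWT-at n T SA 1≤j SA-k≡1+j ⟩
      T j                  ∎

module BalancedSequence {n : ℕ} {T SA ISA : ℕ → ℕ} {kk : ℕ} {p : ℕ → ℕ}
  (text : IsText n T) (sa : IsSA n T SA) (isa : IsISA n SA ISA)
  (bal : IsBalancedSeqPhiInv n T SA ISA kk p) where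

  open SuffixArray text sa isa

  p-1≡1 : p 1 ≡ 1
  p-1≡1 = proj₁ (proj₂ bal)

  p-end : p (suc kk) ≡ suc n
  p-end = proj₁ (proj₂ (proj₂ bal))

  p-inc : ∀ x → 1 ≤ x → x ≤ kk → p x < p (suc x)
  p-inc = proj₁ (proj₂ (proj₂ (proj₂ bal)))

  runEnd-start : ∀ k → 1 ≤ k → k ≤ n → IsRunEnd n T SA k → ∃[ y ] (1 ≤ y × y ≤ kk × p y ≡ SA k)
  runEnd-start = proj₁ (proj₂ (proj₂ (proj₂ (proj₂ bal))))

  φ⁻¹-shift : ∀ x i → 1 ≤ x → x ≤ kk → p x ≤ i → i < p (suc x) →
    phiInv n SA ISA i ≡ phiInv n SA ISA (p x) + (i ∸ p x)
  φ⁻¹-shift = proj₂ (proj₂ (proj₂ (proj₂ (proj₂ bal))))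

  p-mono : ∀ {x y} → 1 ≤ x → x ≤ y → y ≤ suc kk → p x ≤ p y
  p-mono = increasing⇒monotone p p-inc

  module _ {x : ℕ} (1≤x : 1 ≤ x) (x≤kk : x ≤ kk) where

    1≤p : 1 ≤ p x
    1≤p = subst (_≤ p x) p-1≡1 (p-mono ≤-refl 1≤x (≤-trans x≤kk (n≤1+n kk)))

    p-suc-≤ : p (suc x) ≤ suc n
    p-suc-≤ = subst (p (suc x) ≤_) p-end (p-mono (s≤s z≤n) (s≤s x≤kk) ≤-refl)

    interior-¬start : ∀ {j y} → p x ≤ j → suc j < p (suc x) → 1 ≤ y → y ≤ kk → p y ≢ suc j
    interior-¬start {j} {y} p≤j 1+j<p′ 1≤y y≤kk p-y≡1+j with y ≤? x
    ... | yes y≤x = <⇒≱ (s≤s p≤j) (subst (_≤ p x) p-y≡1+j (p-mono 1≤y y≤x (≤-trans x≤kk (n≤1+n kk))))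
    ... | no y≰x  = <⇒≱ 1+j<p′ (subst (p (suc x) ≤_) p-y≡1+j
                      (p-mono (s≤s z≤n) (≰⇒> y≰x) (≤-trans y≤kk (n≤1+n kk))))

    interior-¬IsRunEnd : ∀ {j} → p x ≤ j → suc j < p (suc x) → ¬ IsRunEnd n T SA (ISA (suc j))
    interior-¬IsRunEnd {j} p≤j 1+j<p′ runEnd
      with isa (suc j) (s≤s z≤n) (≤-pred (≤-trans 1+j<p′ p-suc-≤))
    ... | 1≤k , k≤n , SA-k≡1+j with runEnd-start _ 1≤k k≤n runEnd
    ...   | y , 1≤y , y≤kk , p-y≡SA-k = interior-¬start p≤j 1+j<p′ 1≤y y≤kk (trans p-y≡SA-k SA-k≡1+j)

    PLCPφ⁻¹-interior-suc : ∀ j → p x ≤ j → suc j < p (suc x) → suc (PLCPφ⁻¹ (suc j)) ≡ PLCPφ⁻¹ j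
    PLCPφ⁻¹-interior-suc j p≤j 1+j<p′ =
      PLCPφ⁻¹-suc (≤-trans 1≤p p≤j) (≤-pred (≤-trans 1+j<p′ p-suc-≤))
        (interior-¬IsRunEnd p≤j 1+j<p′)
        (shift-suc (phiInv n SA ISA) (λ i → φ⁻¹-shift x i 1≤x x≤kk) p≤j 1+j<p′)

lemma6 : (n : ℕ) (T SA ISA : ℕ → ℕ) (kk : ℕ) (p : ℕ → ℕ) →
    IsText n T → IsSA n T SA → IsISA n SA ISA →
    IsBalancedSeqPhiInv n T SA ISA kk p →
    ∀ x → 1 ≤ x → x ≤ kk →
    ((∀ i → 1 ≤ i → i ≤ n → p x ≤ i → i < p (suc x) →
        + PLCP n T SA ISA (phiInv n SA ISA i)
          ≡ + PLCP n T SA ISA (phiInv n SA ISA (p x)) - (+ i - + p x))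
    × (∀ i j → p x ≤ i → i < p (suc x) → p x ≤ j → j < p (suc x) →
        (+ PLCP n T SA ISA (phiInv n SA ISA i)
           ≡ + PLCP n T SA ISA (phiInv n SA ISA (p x)) - (+ i - + p x))
        × (+ PLCP n T SA ISA (phiInv n SA ISA j)
           ≡ + PLCP n T SA ISA (phiInv n SA ISA (p x)) - (+ j - + p x))
        × (+ PLCP n T SA ISA (phiInv n SA ISA i) - + PLCP n T SA ISA (phiInv n SA ISA j)
           ≡ + j - + i)))
lemma6 n T SA ISA kk p text sa isa bal x 1≤x x≤kk =
    (λ i _ _ → inInterval i)
  , λ i j p≤i i<p′ p≤j j<p′ →
      inInterval i p≤i i<p′ , inInterval j p≤j j<p′ ,
      trans (cong₂ _-_ (inInterval i p≤i i<p′) (inInterval j p≤j j<p′))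
            ([b-[i-s]]-[b-[j-s]]≡j-i (+ PLCPφ⁻¹ (p x)) (+ i) (+ j) (+ p x))
  where
  open SuffixArray text sa isa
  open BalancedSequence text sa isa bal

  inInterval : ∀ i → p x ≤ i → i < p (suc x) → + PLCPφ⁻¹ i ≡ + PLCPφ⁻¹ (p x) - (+ i - + p x)
  inInterval i p≤i i<p′ = a+[i∸s]≡b⇒+a≡+b-[+i-+s] p≤i
    (telescope PLCPφ⁻¹ (PLCPφ⁻¹-interior-suc 1≤x x≤kk) i p≤i i<p′)
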